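{- For all non-negative integers $m\geq n$, $$\sum_{k=0}^n(m-2k)\binom{m}{k}^3=(m-n)\binom{m}{n}\sum_{j=0}^{m-n-1}\binom{n+j}{n}\binom{n+j}{m-n-1}.$$
   Context: Convention: an empty sum equals $0$, and $\binom{N}{k}=0$ whenever $k<0$ or $k>N$. -}

module Defs where

open import Data.Nat using (ℕ; zero; suc)
open import Data.Integer using (ℤ; _+_)

sumTo : ℕ → (ℕ → ℤ) → ℤ
sumTo zero    f = Data.Integer.0ℤ
sumTo (suc n) f = sumTo n f + f n

module Submission where

-- Write C(m,k) for binomial coefficients, S(N,a,b) = Σ_{i<N} C(i,a) C(i,b),
-- and L(m,n) = Σ_{k≤n} (m − 2k) C(m,k)³.  For n + l = m we show
--
--     L(m,n) = l · C(m,n) · S(m, n, l − 1),                              (★)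
--
-- by induction on n with m fixed.  The step from n to n + 1 rests on
--   * absorption  (k+1) C(m,k+1) = (m−k) C(m,k), turning (l+1) C(m,n)
--     into (n+1) C(m,n+1), and symmetry C(m,n+1) = C(m,l);
--   * the recurrence  l·S(N,a+1,l−1) − (a+1)·S(N,a,l) = (l−a−1) C(N,a+1) C(N,l),
--     which for l > 0 is a telescoping sum (each increment follows from
--     absorption) and for l = 0 is the hockey-stick identity S(N,a,0) = C(N,a+1).

open import Defs
open import Data.Nat using (ℕ; suc; _≤_; _∸_)
open import Data.Nat.Combinatorics using (_C_)
open import Data.Integer using (ℤ; +_; _-_; _*_)
open import Relation.Binary.PropositionalEquality using (_≡_)

open import Data.Nat using (zero; _<_) renaming (_+_ to _⊕_)
import Data.Nat.Properties as ℕ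
open import Data.Nat.Properties using (+-suc; m≤m+n; m+n∸m≡n; m+[n∸m]≡n; m≤n⇒m≤1+n; n<1+n)
open import Data.Nat.Combinatorics using (nCk+nC[k+1]≡[n+1]C[k+1]; nCk≡nC[n∸k]; k>n⇒nCk≡0; nCn≡1; nC1≡n)
open import Data.Integer using (_+_; 0ℤ)
open import Data.Integer.Properties using (*-comm; *-zeroʳ; *-zeroˡ; *-identityʳ; +-comm; +-assoc; +-identityʳ; +-identityˡ)
open import Data.Integer.Tactic.RingSolver using (solve-∀)
open import Relation.Binary.PropositionalEquality using (refl; sym; trans; cong; cong₂; module ≡-Reasoning)

open ≡-Reasoning

pos-sub : ∀ {k l m} → k ⊕ l ≡ m → + m - + k ≡ + l
pos-sub {k} {l} refl = cancel (+ k) (+ l)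
  where
    cancel : ∀ x y → (x + y) - x ≡ y
    cancel = solve-∀

sumTo-cong : ∀ N {f g : ℕ → ℤ} → (∀ i → f i ≡ g i) → sumTo N f ≡ sumTo N g
sumTo-cong zero    f≡g = refl
sumTo-cong (suc N) f≡g = cong₂ _+_ (sumTo-cong N f≡g) (f≡g N)

sumTo-vanish : ∀ N (f : ℕ → ℤ) → (∀ i → i < N → f i ≡ 0ℤ) → sumTo N f ≡ 0ℤ
sumTo-vanish zero    f f≡0 = refl
sumTo-vanish (suc N) f f≡0 =
  cong₂ _+_ (sumTo-vanish N f (λ i i<N → f≡0 i (m≤n⇒m≤1+n i<N))) (f≡0 N (n<1+n N))

sumTo-split : ∀ n l (f : ℕ → ℤ) → sumTo (n ⊕ l) f ≡ sumTo n f + sumTo l (λ j → f (n ⊕ j))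
sumTo-split n zero    f = trans (cong (λ k → sumTo k f) (ℕ.+-identityʳ n)) (sym (+-identityʳ (sumTo n f)))
sumTo-split n (suc l) f = begin
  sumTo (n ⊕ suc l) f                                          ≡⟨ cong (λ k → sumTo k f) (+-suc n l) ⟩
  sumTo (n ⊕ l) f + f (n ⊕ l)                                  ≡⟨ cong (_+ f (n ⊕ l)) (sumTo-split n l f) ⟩
  sumTo n f + sumTo l (λ j → f (n ⊕ j)) + f (n ⊕ l)            ≡⟨ +-assoc (sumTo n f) _ (f (n ⊕ l)) ⟩
  sumTo n f + sumTo (suc l) (λ j → f (n ⊕ j))                  ∎

sumTo-drop : ∀ {n l m} (f : ℕ → ℤ) → n ⊕ l ≡ m → (∀ i → i < n → f i ≡ 0ℤ) →
             sumTo m f ≡ sumTo l (λ j → f (n ⊕ j))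
sumTo-drop {n} {l} f refl f≡0 = begin
  sumTo (n ⊕ l) f                           ≡⟨ sumTo-split n l f ⟩
  sumTo n f + sumTo l (λ j → f (n ⊕ j))     ≡⟨ cong (_+ sumTo l (λ j → f (n ⊕ j))) (sumTo-vanish n f f≡0) ⟩
  0ℤ + sumTo l (λ j → f (n ⊕ j))            ≡⟨ +-identityˡ _ ⟩
  sumTo l (λ j → f (n ⊕ j))                 ∎

binom : ℕ → ℕ → ℤ
binom n k = + (n C k)

binom-pascal : ∀ n k → binom n k + binom n (suc k) ≡ binom (suc n) (suc k)
binom-pascal n k = cong +_ (nCk+nC[k+1]≡[n+1]C[k+1] n k)

binom-vanish : ∀ {n k} → n < k → binom n k ≡ 0ℤ
binom-vanish n<k = cong +_ (k>n⇒nCk≡0 n<k)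

binom-sym : ∀ {k l m} → k ⊕ l ≡ m → binom m k ≡ binom m l
binom-sym {k} {l} refl =
  cong +_ (trans (nCk≡nC[n∸k] (m≤m+n k l)) (cong ((k ⊕ l) C_) (m+n∸m≡n k l)))

binom-absorb : ∀ n k → + suc k * binom n (suc k) ≡ (+ n - + k) * binom n k
binom-absorb zero    zero    = refl
binom-absorb zero    (suc k) = trans (*-zeroʳ (+ suc (suc k))) (sym (*-zeroʳ (+ 0 - + suc k)))
binom-absorb (suc n) zero    = trans (cong (λ t → + 1 * + t) (nC1≡n (suc n))) (one (+ suc n))
  where
    one : ∀ x → + 1 * x ≡ (x - + 0) * + 1
    one = solve-∀
binom-absorb (suc n) (suc k) = begin
  + suc (suc k) * binom (suc n) (suc (suc k))
    ≡⟨ cong (+ suc (suc k) *_) (sym (binom-pascal n (suc k))) ⟩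
  + suc (suc k) * (Q + R)
    ≡⟨ expand (+ k) Q R ⟩
  Q + + suc k * Q + + suc (suc k) * R
    ≡⟨ cong₂ (λ x y → Q + x + y) (binom-absorb n k) (binom-absorb n (suc k)) ⟩
  Q + (+ n - + k) * P + (+ n - + suc k) * Q
    ≡⟨ collect (+ n) (+ k) P Q ⟩
  (+ suc n - + suc k) * (P + Q)
    ≡⟨ cong ((+ suc n - + suc k) *_) (binom-pascal n k) ⟩
  (+ suc n - + suc k) * binom (suc n) (suc k) ∎
  where
    P = binom n k
    Q = binom n (suc k)
    R = binom n (suc (suc k))
    expand : ∀ k Q R → (+ 1 + (+ 1 + k)) * (Q + R) ≡ Q + (+ 1 + k) * Q + (+ 1 + (+ 1 + k)) * R
    expand = solve-∀
    collect : ∀ n k P Q → Q + (n - k) * P + (n - (+ 1 + k)) * Q ≡ ((+ 1 + n) - (+ 1 + k)) * (P + Q)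
    collect = solve-∀

cross : ℕ → ℕ → ℕ → ℤ
cross N a b = sumTo N (λ i → binom i a * binom i b)

cross-sym : ∀ N a b → cross N a b ≡ cross N b a
cross-sym N a b = sumTo-cong N (λ i → *-comm (binom i a) (binom i b))

cross-hockey : ∀ N a → cross N a 0 ≡ binom N (suc a)
cross-hockey zero    a = refl
cross-hockey (suc N) a = begin
  cross N a 0 + binom N a * + 1        ≡⟨ cong₂ _+_ (cross-hockey N a) (*-identityʳ (binom N a)) ⟩
  binom N (suc a) + binom N a          ≡⟨ +-comm (binom N (suc a)) (binom N a) ⟩
  binom N a + binom N (suc a)          ≡⟨ binom-pascal N a ⟩
  binom (suc N) (suc a)                ∎

-- One increment of the telescoping sum: with P,Q,R,U = C(i,a), C(i,a+1), C(i,b), C(i,b+1),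
--   (b+1)QR − (a+1)PU = (b−a)(C(i+1,a+1) C(i+1,b+1) − QU),
-- because both absorptions (a+1)Q = (i−a)P and (b+1)U = (i−b)R cancel the remainder.
cross-increment : ∀ i a b →
  + suc b * (binom i (suc a) * binom i b) - + suc a * (binom i a * binom i (suc b))
    ≡ (+ b - + a) * (binom (suc i) (suc a) * binom (suc i) (suc b) - binom i (suc a) * binom i (suc b))
cross-increment i a b = begin
  + suc b * (Q * R) - + suc a * (P * U)
    ≡⟨ split (+ a) (+ b) P Q R U ⟩
  (+ b - + a) * ((P + Q) * (R + U) - Q * U) + (R * (+ suc a * Q) - P * (+ suc b * U) - (+ b - + a) * (P * R))
    ≡⟨ cong₂ (λ x y → (+ b - + a) * ((P + Q) * (R + U) - Q * U) + (R * x - P * y - (+ b - + a) * (P * R)))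
             (binom-absorb i a) (binom-absorb i b) ⟩
  (+ b - + a) * ((P + Q) * (R + U) - Q * U) + (R * ((+ i - + a) * P) - P * ((+ i - + b) * R) - (+ b - + a) * (P * R))
    ≡⟨ cancel (+ a) (+ b) (+ i) P Q R U ⟩
  (+ b - + a) * ((P + Q) * (R + U) - Q * U)
    ≡⟨ cong₂ (λ x y → (+ b - + a) * (x * y - Q * U)) (binom-pascal i a) (binom-pascal i b) ⟩
  (+ b - + a) * (binom (suc i) (suc a) * binom (suc i) (suc b) - Q * U) ∎
  where
    P = binom i a
    Q = binom i (suc a)
    R = binom i b
    U = binom i (suc b)
    split : ∀ a b P Q R U → (+ 1 + b) * (Q * R) - (+ 1 + a) * (P * U)
      ≡ (b - a) * ((P + Q) * (R + U) - Q * U) + (R * ((+ 1 + a) * Q) - P * ((+ 1 + b) * U) - (b - a) * (P * R))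
    split = solve-∀
    cancel : ∀ a b i P Q R U →
      (b - a) * ((P + Q) * (R + U) - Q * U) + (R * ((i - a) * P) - P * ((i - b) * R) - (b - a) * (P * R))
        ≡ (b - a) * ((P + Q) * (R + U) - Q * U)
    cancel = solve-∀

cross-telescope : ∀ N a b →
  + suc b * cross N (suc a) b - + suc a * cross N a (suc b) ≡ (+ b - + a) * (binom N (suc a) * binom N (suc b))
cross-telescope zero    a b = vanish (+ suc b) (+ suc a) (+ b - + a)
  where
    vanish : ∀ x y z → x * 0ℤ - y * 0ℤ ≡ z * (+ 0 * + 0)
    vanish = solve-∀
cross-telescope (suc N) a b = begin
  + suc b * (S₁ + Q * R) - + suc a * (S₂ + P * U)
    ≡⟨ regroup (+ suc b) (+ suc a) S₁ S₂ (Q * R) (P * U) ⟩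
  (+ suc b * S₁ - + suc a * S₂) + (+ suc b * (Q * R) - + suc a * (P * U))
    ≡⟨ cong₂ _+_ (cross-telescope N a b) (cross-increment N a b) ⟩
  (+ b - + a) * (Q * U) + (+ b - + a) * (binom (suc N) (suc a) * binom (suc N) (suc b) - Q * U)
    ≡⟨ collapse (+ b - + a) (Q * U) (binom (suc N) (suc a) * binom (suc N) (suc b)) ⟩
  (+ b - + a) * (binom (suc N) (suc a) * binom (suc N) (suc b)) ∎
  where
    S₁ = cross N (suc a) b
    S₂ = cross N a (suc b)
    P = binom N a
    Q = binom N (suc a)
    R = binom N b
    U = binom N (suc b)
    regroup : ∀ y x S₁ S₂ s t → y * (S₁ + s) - x * (S₂ + t) ≡ (y * S₁ - x * S₂) + (y * s - x * t)
    regroup = solve-∀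
    collapse : ∀ c s t → c * s + c * (t - s) ≡ c * t
    collapse = solve-∀

cross-recurrence : ∀ N a l →
  + l * cross N (suc a) (l ∸ 1) - + suc a * cross N a l ≡ (+ l - + suc a) * (binom N (suc a) * binom N l)
cross-recurrence N a zero = begin
  + 0 * cross N (suc a) 0 - + suc a * cross N a 0       ≡⟨ cong (λ t → + 0 * cross N (suc a) 0 - + suc a * t) (cross-hockey N a) ⟩
  + 0 * cross N (suc a) 0 - + suc a * binom N (suc a)   ≡⟨ hockey (+ a) (cross N (suc a) 0) (binom N (suc a)) ⟩
  (+ 0 - + suc a) * (binom N (suc a) * + 1)             ∎
  where
    hockey : ∀ a S B → + 0 * S - (+ 1 + a) * B ≡ (+ 0 - (+ 1 + a)) * (B * + 1)
    hockey = solve-∀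
cross-recurrence N a (suc b) =
  trans (cross-telescope N a b) (cong (_* (binom N (suc a) * binom N (suc b))) (shift (+ a) (+ b)))
  where
    shift : ∀ a b → b - a ≡ (+ 1 + b) - (+ 1 + a)
    shift = solve-∀

cubeSum : ℕ → ℕ → ℤ
cubeSum m n = sumTo (suc n) (λ k → (+ m - + 2 * + k) * (binom m k * binom m k * binom m k))

cubeSum-closed : ∀ {m} n l → n ⊕ l ≡ m → cubeSum m n ≡ + l * binom m n * cross m n (l ∸ 1)
cubeSum-closed zero zero    refl = refl
cubeSum-closed zero (suc b) refl = begin
  0ℤ + (+ suc b - + 2 * + 0) * (+ 1 * + 1 * + 1)   ≡⟨ base (+ suc b) ⟩
  + suc b * + 1 * + 1                              ≡⟨ cong (+ suc b * + 1 *_) (sym S≡1) ⟩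
  + suc b * + 1 * cross (suc b) 0 b                ∎
  where
    base : ∀ x → 0ℤ + (x - + 2 * + 0) * (+ 1 * + 1 * + 1) ≡ x * + 1 * + 1
    base = solve-∀
    S≡1 : cross (suc b) 0 b ≡ + 1
    S≡1 = trans (cross-sym (suc b) 0 b) (trans (cross-hockey (suc b) b) (cong +_ (nCn≡1 (suc b))))
cubeSum-closed {m} (suc n) l n+l≡m = begin
  cubeSum m n + (+ m - + 2 * + suc n) * (c * c * c)
    ≡⟨ cong₂ _+_ (cubeSum-closed n (suc l) n+1+l≡m) (cong (_* (c * c * c)) coefficient) ⟩
  + suc l * binom m n * X + (+ l - + suc n) * (c * c * c)
    ≡⟨ cong (λ t → t * X + (+ l - + suc n) * (c * c * c)) absorption ⟩
  + suc n * c * X + (+ l - + suc n) * (c * c * c)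
    ≡⟨ factor (+ suc n) (+ l) c X ⟩
  c * (+ suc n * X + (+ l - + suc n) * (c * c))
    ≡⟨ cong (λ t → c * (+ suc n * X + (+ l - + suc n) * (c * t))) (binom-sym {suc n} n+l≡m) ⟩
  c * (+ suc n * X + (+ l - + suc n) * (c * binom m l))
    ≡⟨ cong (λ t → c * (+ suc n * X + t)) (sym (cross-recurrence m n l)) ⟩
  c * (+ suc n * X + (+ l * Y - + suc n * X))
    ≡⟨ finish (+ suc n) (+ l) c X Y ⟩
  + l * c * Y ∎
  where
    c = binom m (suc n)
    X = cross m n l
    Y = cross m (suc n) (l ∸ 1)
    n+1+l≡m : n ⊕ suc l ≡ m
    n+1+l≡m = trans (+-suc n l) n+l≡m
    coefficient : + m - + 2 * + suc n ≡ + l - + suc n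
    coefficient = trans (twice (+ m) (+ suc n)) (cong (_- + suc n) (pos-sub {suc n} n+l≡m))
      where
        twice : ∀ x y → x - + 2 * y ≡ (x - y) - y
        twice = solve-∀
    -- (l+1) C(m,n) = (m−n) C(m,n) = (n+1) C(m,n+1)
    absorption : + suc l * binom m n ≡ + suc n * c
    absorption = sym (trans (binom-absorb m n) (cong (_* binom m n) (pos-sub {n} n+1+l≡m)))
    factor : ∀ s t c X → s * c * X + (t - s) * (c * c * c) ≡ c * (s * X + (t - s) * (c * c))
    factor = solve-∀
    finish : ∀ s t c X Y → c * (s * X + (t * Y - s * X)) ≡ t * c * Y
    finish = solve-∀

-- With n + l = m, the terms i < n of S(m,n,b) vanish.
cross-shift : ∀ {n l m} b → n ⊕ l ≡ m →
  cross m n b ≡ sumTo l (λ j → binom (n ⊕ j) n * binom (n ⊕ j) b)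
cross-shift {n} {l} b n+l≡m = sumTo-drop {n} {l} (λ i → binom i n * binom i b) n+l≡m
  (λ i i<n → trans (cong (_* binom i b) (binom-vanish i<n)) (*-zeroˡ (binom i b)))

lemma2p1 : (m n : ℕ) → n ≤ m →
    sumTo (suc n) (λ k → ((+ m) - (+ 2 * + k)) * (+ (m C k) * + (m C k) * + (m C k)))
    ≡ (+ m - + n) * + (m C n)
    * sumTo (m ∸ n) (λ j → + ((n Data.Nat.+ j) C n) * + ((n Data.Nat.+ j) C (m ∸ n ∸ 1)))
lemma2p1 m n n≤m = begin
  cubeSum m n
    ≡⟨ cubeSum-closed n l n+l≡m ⟩
  + l * binom m n * cross m n (l ∸ 1)
    ≡⟨ cong₂ (λ x y → x * binom m n * y) (sym (pos-sub {n} n+l≡m)) (cross-shift {n} (l ∸ 1) n+l≡m) ⟩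
  (+ m - + n) * binom m n * sumTo l (λ j → binom (n ⊕ j) n * binom (n ⊕ j) (l ∸ 1)) ∎
  where
    l = m ∸ n
    n+l≡m : n ⊕ l ≡ m
    n+l≡m = m+[n∸m]≡n n≤m
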